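{- The intersection $\mathcal Q^+\cap\mathcal H$ consists of the points of $\mathcal Q_0$ together with all points contained in extended generators of $\mathcal Q_0$.
   Context: Let $q$ be an odd prime power; points of $\mathrm{PG}(3,q^2)$ are $\langle(\alpha,\beta,\gamma,\delta)\rangle$. $\mathcal Q^+$ is the quadric $\alpha\delta-\beta\gamma=0$ and $\mathcal H$ the Hermitian surface $\alpha^{q+1}-\beta^{q+1}-\gamma^{q+1}+\delta^{q+1}=0$. $\Sigma=\{\langle(\alpha,\beta,\beta^q,\alpha^q)\rangle\}$ is a Baer subgeometry $\cong\mathrm{PG}(3,q)$ and $\mathcal Q_0=\mathcal Q^+\cap\Sigma$ is a hyperbolic quadric of $\Sigma$. An extended generator of $\mathcal Q_0$ is a line of $\mathrm{PG}(3,q^2)$ containing a line of $\Sigma$ that is contained in $\mathcal Q_0$. -}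

module Defs where

open import Level using (0ℓ)
open import Data.Nat as ℕ using (ℕ; zero; suc)
open import Data.Nat.Primality using (Prime)
open import Data.Fin using (Fin)
open import Data.Product using (Σ; ∃; ∃-syntax; _×_; _,_)
open import Data.Sum using (_⊎_)
open import Relation.Nullary using (¬_)
open import Relation.Binary.PropositionalEquality using (_≡_)
open import Function.Bundles using (_↔_)
import Algebra.Structures as AS

record Field : Set₁ where
  infixl 6 _+_
  infixl 7 _*_
  infix  8 -_
  infixl 6 _-_
  infixr 9 _^_
  field
    Carrier : Set
    _+_ _*_ : Carrier → Carrier → Carrier
    -_      : Carrier → Carrier
    0# 1#   : Carrier
    isCommutativeRing : AS.IsCommutativeRing _≡_ _+_ _*_ -_ 0# 1#
    0≢1     : ¬ (0# ≡ 1#)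
    inv     : Carrier → Carrier
    inv-r   : ∀ x → ¬ (x ≡ 0#) → x * inv x ≡ 1#

  _-_ : Carrier → Carrier → Carrier
  x - y = x + (- y)

  _^_ : Carrier → ℕ → Carrier
  x ^ zero  = 1#
  x ^ suc n = x * (x ^ n)

OddPrimePower : ℕ → Set
OddPrimePower q = ∃[ p ] ∃[ k ] (Prime p × ¬ (p ≡ 2) × 1 ℕ.≤ k × q ≡ p ℕ.^ k)

-- F is a finite field of order n (hence F ≅ GF(n)).
HasOrder : Field → ℕ → Set
HasOrder F n = Fin n ↔ Field.Carrier F

-- Geometry in PG(3, q²) over a field F ≅ GF(q²).
module Geometry (F : Field) (q : ℕ) where
  open Field F

  -- homogeneous coordinates (α, β, γ, δ)
  record V4 : Set where
    constructor v4
    field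
      α β γ δ : Carrier
  open V4 public

  Nonzero : V4 → Set
  Nonzero v = ¬ (α v ≡ 0# × β v ≡ 0# × γ v ≡ 0# × δ v ≡ 0#)

  scale : Carrier → V4 → V4
  scale c v = v4 (c * α v) (c * β v) (c * γ v) (c * δ v)

  add : V4 → V4 → V4
  add u v = v4 (α u + α v) (β u + β v) (γ u + γ v) (δ u + δ v)

  -- u and v represent the same projective point (v nonzero assumed where used)
  SamePoint : V4 → V4 → Set
  SamePoint u v = ∃[ c ] (¬ (c ≡ 0#) × u ≡ scale c v)

  InQ+ : V4 → Set
  InQ+ v = α v * δ v - β v * γ v ≡ 0#

  InH : V4 → Set
  InH v = (α v ^ suc q) - (β v ^ suc q) - (γ v ^ suc q) + (δ v ^ suc q) ≡ 0#

  σ : Carrier → Carrier → V4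
  σ a b = v4 a b (b ^ q) (a ^ q)

  InΣ : V4 → Set
  InΣ v = Nonzero v × ∃[ a ] ∃[ b ] SamePoint v (σ a b)

  InQ0 : V4 → Set
  InQ0 v = InΣ v × InQ+ v

  OnSpan : V4 → V4 → V4 → Set
  OnSpan u w v = ∃[ λ₁ ] ∃[ μ ] v ≡ add (scale λ₁ u) (scale μ w)

  -- u, w are representatives of two distinct points of Σ, and every point of Σ
  -- on the line they span lies in Q⁺ (i.e. the line of Σ spanned by u, w is
  -- contained in Q₀): the line of PG(3,q²) spanned by u, w is an extended
  -- generator of Q₀.
  ExtendedGenerator : V4 → V4 → Set
  ExtendedGenerator u w =
    InΣ u × InΣ w × ¬ SamePoint w u ×
    (∀ x → InΣ x → OnSpan u w x → InQ+ x)

  OnExtendedGenerator : V4 → Set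
  OnExtendedGenerator v = ∃[ u ] ∃[ w ] (ExtendedGenerator u w × OnSpan u w v)

-- Over F = GF(q²) the map x ↦ x̄ = x ^ q is an involutive field automorphism (Freshman's dream
-- and Fermat's little theorem) whose fixed field GF(q) is proper, because X ^ q - X has at most
-- q roots. Write N x = x x̄. On Σ the Hermitian form is twice the quadratic one, so Q₀ ⊆ H; and
-- on the span of two points of Σ both forms are combinations of the values of the sesquilinear
-- form (a, b | a′, b′) ↦ a ā′ - b b̄′ at the spanning points, which all vanish when the Baer
-- subline they span lies on Q⁺; hence extended generators lie in Q⁺ ∩ H. Conversely, for a point
-- (a, b, c, d) of Q⁺ ∩ H the norms satisfy N a N d = N b N c and N a - N b - N c + N d = 0, so
-- (N a - N b)(N a - N c) = 0, and the point lies on a line {(s, t, ω s, ω t)} or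
-- {(s, ω s, t, ω t)} with N ω = 1. Such a line meets Σ in the Baer subline through
-- σ(1, ω̄) and σ(e, ω̄ ē) for any e ∉ GF(q), and that subline spans it: it is an extended generator.

module Submission where

open import Defs
open import Level using (0ℓ)
open import Data.Nat as ℕ using (ℕ; zero; suc; _!; _<_; _≤_; z≤n; s≤s)
import Data.Nat.Properties as ℕ
open import Data.Nat.Divisibility using (_∣_; divides; ∣⇒≤; m∣m*n; ∣1⇒≡1)
open import Data.Nat.DivMod using (m/n*n≡m)
open import Data.Nat.Primality using (Prime; euclidsLemma; prime⇒nonTrivial; prime⇒nonZero)
open import Data.Nat.Combinatorics using (_C_; nCn≡1; nCk≡n!/k![n-k]!; k![n∸k]!∣n!)
open import Data.Integer as ℤ using (ℤ; -[1+_]; _⊖_; 0ℤ; 1ℤ)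
import Data.Integer.Properties as ℤ
open import Data.Fin as Fin using (Fin)
import Data.Fin.Properties as Fin
open import Data.Vec using (Vec; []; _∷_; last)
open import Data.Maybe using (Maybe; just; nothing)
open import Data.Product using (∃-syntax; _×_; _,_; proj₁; proj₂)
import Data.Product
open import Data.Sum using (_⊎_; inj₁; inj₂; [_,_])
open import Data.Empty using (⊥-elim)
open import Function.Base using (_∘_; id)
open import Function.Bundles using (_↔_; Inverse; _⇔_; mk⇔; mk↔ₛ′)
open import Function.Construct.Composition using (_↔-∘_)
open import Function.Construct.Symmetry using (↔-sym)
open import Relation.Nullary using (¬_; yes; no)
open import Relation.Nullary.Decidable using (decidable-stable)
open import Relation.Binary.Definitions using (DecidableEquality)
open import Relation.Binary.PropositionalEquality as ≡
  using (_≡_; refl; sym; trans; cong; cong₂; subst; module ≡-Reasoning)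
open import Algebra.Bundles using (CommutativeRing; CommutativeSemiring; CommutativeMonoid)
open import Algebra.Solver.Ring.AlmostCommutativeRing using (fromCommutativeRing; _-Raw-AlmostCommutative⟶_)
import Algebra.Properties.CommutativeMonoid.Sum
import Algebra.Properties.Monoid.Sum
import Algebra.Properties.Monoid.Mult
import Algebra.Properties.Semiring.Mult
import Algebra.Properties.Semiring.Exp
import Algebra.Properties.CommutativeSemiring.Exp

-- Integer coefficients have canonical normal forms, so `solve n (λ … → lhs := rhs) refl` decides
-- every ring identity, including those that cancel terms such as x - x.
module IntegerCoefficientSolver (R : CommutativeRing 0ℓ 0ℓ) where

  private
    open CommutativeRing R
      using (Carrier; _≈_; _+_; _*_; -_; _-_; 0#; 1#; setoid; semiring; ring; +-abelianGroup;
             +-assoc; +-comm; +-identityˡ; +-identityʳ; -‿inverseʳ; distribʳ; *-identityˡ; zeroˡ;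
             +-cong; +-congˡ; +-congʳ; *-congʳ; -‿cong)
      renaming (refl to ≈-refl; sym to ≈-sym; trans to ≈-trans)
    open import Algebra.Properties.Semiring.Mult.TCOptimised semiring using (1+×; ×-homo-+) renaming (_×_ to _·_)
    open import Algebra.Properties.Ring ring using (-‿distribˡ-*; -‿involutive; -0#≈0#)
    open import Algebra.Properties.AbelianGroup +-abelianGroup using (⁻¹-∙-comm)
    open import Relation.Binary.Reasoning.Setoid setoid

    ⟦_⟧ℤ : ℤ → Carrier
    ⟦ ℤ.+ n ⟧ℤ = n · 1#
    ⟦ -[1+ n ] ⟧ℤ = - (suc n · 1#)

    [1+x]-[1+y]≈x-y : ∀ x y → (1# + x) - (1# + y) ≈ x - y
    [1+x]-[1+y]≈x-y x y = begin
      (1# + x) + - (1# + y)     ≈⟨ +-congˡ (⁻¹-∙-comm 1# y) ⟨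
      (1# + x) + (- 1# + - y)   ≈⟨ +-assoc 1# x _ ⟩
      1# + (x + (- 1# + - y))   ≈⟨ +-congˡ (+-assoc x (- 1#) (- y)) ⟨
      1# + ((x + - 1#) + - y)   ≈⟨ +-congˡ (+-congʳ (+-comm x (- 1#))) ⟩
      1# + ((- 1# + x) + - y)   ≈⟨ +-congˡ (+-assoc (- 1#) x (- y)) ⟩
      1# + (- 1# + (x + - y))   ≈⟨ +-assoc 1# (- 1#) _ ⟨
      (1# + - 1#) + (x + - y)   ≈⟨ +-congʳ (-‿inverseʳ 1#) ⟩
      0# + (x + - y)            ≈⟨ +-identityˡ _ ⟩
      x + - y                   ∎

    ⊖-homo : ∀ m n → ⟦ m ⊖ n ⟧ℤ ≈ m · 1# - n · 1#
    ⊖-homo m zero = begin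
      m · 1#           ≈⟨ +-identityʳ _ ⟨
      m · 1# + 0#      ≈⟨ +-congˡ -0#≈0# ⟨
      m · 1# - 0#      ∎
    ⊖-homo zero (suc n) = ≈-sym (+-identityˡ _)
    ⊖-homo (suc m) (suc n) = begin
      ⟦ suc m ⊖ suc n ⟧ℤ               ≡⟨ ≡.cong ⟦_⟧ℤ (ℤ.[1+m]⊖[1+n]≡m⊖n m n) ⟩
      ⟦ m ⊖ n ⟧ℤ                       ≈⟨ ⊖-homo m n ⟩
      m · 1# - n · 1#                  ≈⟨ [1+x]-[1+y]≈x-y _ _ ⟨
      (1# + m · 1#) - (1# + n · 1#)    ≈⟨ +-cong (≈-sym (1+× m 1#)) (-‿cong (≈-sym (1+× n 1#))) ⟩
      suc m · 1# - suc n · 1#          ∎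

    +-homo : ∀ i j → ⟦ i ℤ.+ j ⟧ℤ ≈ ⟦ i ⟧ℤ + ⟦ j ⟧ℤ
    +-homo (ℤ.+ m) (ℤ.+ n) = ×-homo-+ 1# m n
    +-homo (ℤ.+ m) -[1+ n ] = ⊖-homo m (suc n)
    +-homo -[1+ m ] (ℤ.+ n) = ≈-trans (⊖-homo n (suc m)) (+-comm _ _)
    +-homo -[1+ m ] -[1+ n ] = begin
      - (suc (suc (m ℕ.+ n)) · 1#)          ≡⟨ ≡.cong (λ k → - (k · 1#)) (ℕ.+-suc (suc m) n) ⟨
      - ((suc m ℕ.+ suc n) · 1#)            ≈⟨ -‿cong (×-homo-+ 1# (suc m) (suc n)) ⟩
      - (suc m · 1# + suc n · 1#)           ≈⟨ ⁻¹-∙-comm _ _ ⟨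
      - (suc m · 1#) + - (suc n · 1#)       ∎

    neg-homo : ∀ i → ⟦ ℤ.- i ⟧ℤ ≈ - ⟦ i ⟧ℤ
    neg-homo (ℤ.+ zero) = ≈-sym -0#≈0#
    neg-homo (ℤ.+ suc n) = ≈-refl
    neg-homo -[1+ n ] = ≈-sym (-‿involutive _)

    +m*-homo : ∀ m j → ⟦ ℤ.+ m ℤ.* j ⟧ℤ ≈ m · 1# * ⟦ j ⟧ℤ
    +m*-homo zero j = ≈-sym (zeroˡ _)
    +m*-homo (suc m) j = begin
      ⟦ ℤ.+ suc m ℤ.* j ⟧ℤ              ≡⟨ ≡.cong ⟦_⟧ℤ (ℤ.suc-* (ℤ.+ m) j) ⟩
      ⟦ j ℤ.+ ℤ.+ m ℤ.* j ⟧ℤ            ≈⟨ +-homo j (ℤ.+ m ℤ.* j) ⟩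
      ⟦ j ⟧ℤ + ⟦ ℤ.+ m ℤ.* j ⟧ℤ          ≈⟨ +-cong (≈-sym (*-identityˡ _)) (+m*-homo m j) ⟩
      1# * ⟦ j ⟧ℤ + m · 1# * ⟦ j ⟧ℤ      ≈⟨ distribʳ _ _ _ ⟨
      (1# + m · 1#) * ⟦ j ⟧ℤ             ≈⟨ *-congʳ (1+× m 1#) ⟨
      suc m · 1# * ⟦ j ⟧ℤ                ∎

    *-homo : ∀ i j → ⟦ i ℤ.* j ⟧ℤ ≈ ⟦ i ⟧ℤ * ⟦ j ⟧ℤ
    *-homo (ℤ.+ m) j = +m*-homo m j
    *-homo -[1+ m ] j = begin
      ⟦ -[1+ m ] ℤ.* j ⟧ℤ                ≡⟨ ≡.cong ⟦_⟧ℤ (ℤ.neg-distribˡ-* (ℤ.+ suc m) j) ⟨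
      ⟦ ℤ.- (ℤ.+ suc m ℤ.* j) ⟧ℤ         ≈⟨ neg-homo (ℤ.+ suc m ℤ.* j) ⟩
      - ⟦ ℤ.+ suc m ℤ.* j ⟧ℤ             ≈⟨ -‿cong (+m*-homo (suc m) j) ⟩
      - (suc m · 1# * ⟦ j ⟧ℤ)            ≈⟨ -‿distribˡ-* _ _ ⟩
      - (suc m · 1#) * ⟦ j ⟧ℤ            ∎

    ℤ-morphism : ℤ.+-*-rawRing -Raw-AlmostCommutative⟶ fromCommutativeRing R
    ℤ-morphism = record
      { ⟦_⟧ = ⟦_⟧ℤ ; +-homo = +-homo ; *-homo = *-homo ; -‿homo = neg-homo
      ; 0-homo = ≈-refl ; 1-homo = ≈-refl }

    ⟦⟧ℤ-≟ : ∀ i j → Maybe (⟦ i ⟧ℤ ≈ ⟦ j ⟧ℤ)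
    ⟦⟧ℤ-≟ i j with i ℤ.≟ j
    ... | yes ≡.refl = just ≈-refl
    ... | no _ = nothing

  open import Algebra.Solver.Ring ℤ.+-*-rawRing (fromCommutativeRing R) ℤ-morphism ⟦⟧ℤ-≟ public

module FieldProperties (F : Field) where

  open Field F public

  commutativeRing : CommutativeRing 0ℓ 0ℓ
  commutativeRing = record { isCommutativeRing = isCommutativeRing }

  open CommutativeRing commutativeRing public
    using (+-comm; +-assoc; +-identityˡ; +-identityʳ; *-comm; *-assoc; *-identityˡ; *-identityʳ;
           zeroˡ; zeroʳ; semiring; commutativeSemiring; +-commutativeMonoid; *-commutativeMonoid)
  open IntegerCoefficientSolver commutativeRing public using (solve; _:=_; _:+_; _:*_; _:-_; :-_; con)
  open Algebra.Properties.Semiring.Mult semiring public using (×1-homo-*) renaming (_×_ to _·_)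
  module ∏ = Algebra.Properties.CommutativeMonoid.Sum *-commutativeMonoid
  open ≡-Reasoning

  1≢0 : ¬ 1# ≡ 0#
  1≢0 1≡0 = 0≢1 (sym 1≡0)

  -0≡0 : - 0# ≡ 0#
  -0≡0 = solve 0 (:- con 0ℤ := con 0ℤ) refl

  -1≢0 : ¬ - 1# ≡ 0#
  -1≢0 -1≡0 = 1≢0 (begin
    1#          ≡⟨ solve 0 (con 1ℤ := :- (:- con 1ℤ)) refl ⟩
    - (- 1#)    ≡⟨ cong -_ -1≡0 ⟩
    - 0#        ≡⟨ -0≡0 ⟩
    0#          ∎)

  x-y≡0⇒x≡y : ∀ {x y} → x - y ≡ 0# → x ≡ y
  x-y≡0⇒x≡y {x} {y} x-y≡0 = begin
    x              ≡⟨ solve 2 (λ x y → x := (x :- y) :+ y) refl x y ⟩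
    (x - y) + y    ≡⟨ cong (_+ y) x-y≡0 ⟩
    0# + y         ≡⟨ +-identityˡ y ⟩
    y              ∎

  x≡y⇒x-y≡0 : ∀ {x y} → x ≡ y → x - y ≡ 0#
  x≡y⇒x-y≡0 {x} refl = solve 1 (λ x → x :- x := con 0ℤ) refl x

  x+y≡0⇒y≡-x : ∀ {x y} → x + y ≡ 0# → y ≡ - x
  x+y≡0⇒y≡-x {x} {y} x+y≡0 = begin
    y                 ≡⟨ solve 2 (λ x y → y := (x :+ y) :- x) refl x y ⟩
    (x + y) - x       ≡⟨ cong (_- x) x+y≡0 ⟩
    0# - x            ≡⟨ +-identityˡ (- x) ⟩
    - x               ∎

  inv-l : ∀ {x} → ¬ x ≡ 0# → inv x * x ≡ 1#
  inv-l {x} x≢0 = trans (*-comm (inv x) x) (inv-r x x≢0)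

  inv-cancelˡ : ∀ {x} → ¬ x ≡ 0# → ∀ y → inv x * (x * y) ≡ y
  inv-cancelˡ {x} x≢0 y = begin
    inv x * (x * y)   ≡⟨ *-assoc (inv x) x y ⟨
    (inv x * x) * y   ≡⟨ cong (_* y) (inv-l x≢0) ⟩
    1# * y            ≡⟨ *-identityˡ y ⟩
    y                 ∎

  inv-cancelʳ : ∀ {x} → ¬ x ≡ 0# → ∀ y → (y * inv x) * x ≡ y
  inv-cancelʳ {x} x≢0 y = begin
    (y * inv x) * x   ≡⟨ *-assoc y (inv x) x ⟩
    y * (inv x * x)   ≡⟨ cong (y *_) (inv-l x≢0) ⟩
    y * 1#            ≡⟨ *-identityʳ y ⟩
    y                 ∎

  *-cancelˡ-≡0 : ∀ {x y} → ¬ x ≡ 0# → x * y ≡ 0# → y ≡ 0#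
  *-cancelˡ-≡0 {x} {y} x≢0 xy≡0 = begin
    y                 ≡⟨ inv-cancelˡ x≢0 y ⟨
    inv x * (x * y)   ≡⟨ cong (inv x *_) xy≡0 ⟩
    inv x * 0#        ≡⟨ zeroʳ (inv x) ⟩
    0#                ∎

  *-cancelʳ-≡0 : ∀ {x y} → ¬ y ≡ 0# → x * y ≡ 0# → x ≡ 0#
  *-cancelʳ-≡0 {x} {y} y≢0 xy≡0 = *-cancelˡ-≡0 y≢0 (trans (*-comm y x) xy≡0)

  x*y≢0 : ∀ {x y} → ¬ x ≡ 0# → ¬ y ≡ 0# → ¬ x * y ≡ 0#
  x*y≢0 x≢0 y≢0 xy≡0 = y≢0 (*-cancelˡ-≡0 x≢0 xy≡0)

  inv≢0 : ∀ {x} → ¬ x ≡ 0# → ¬ inv x ≡ 0#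
  inv≢0 {x} x≢0 inv≡0 = 1≢0 (trans (sym (inv-l x≢0)) (trans (cong (_* x) inv≡0) (zeroˡ x)))

  private
    module Exp = Algebra.Properties.Semiring.Exp semiring
    module CExp = Algebra.Properties.CommutativeSemiring.Exp commutativeSemiring

  ^≡Exp^ : ∀ x n → x ^ n ≡ x Exp.^ n
  ^≡Exp^ x zero = refl
  ^≡Exp^ x (suc n) = cong (x *_) (^≡Exp^ x n)

  ^-distrib-* : ∀ x y n → (x * y) ^ n ≡ x ^ n * y ^ n
  ^-distrib-* x y n rewrite ^≡Exp^ (x * y) n | ^≡Exp^ x n | ^≡Exp^ y n = CExp.^-distrib-* x y n

  ^-assocʳ : ∀ x m n → (x ^ m) ^ n ≡ x ^ (m ℕ.* n)
  ^-assocʳ x m n rewrite ^≡Exp^ (x ^ m) n | ^≡Exp^ x m | ^≡Exp^ x (m ℕ.* n) = Exp.^-assocʳ x m n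

  1^n≡1 : ∀ n → 1# ^ n ≡ 1#
  1^n≡1 zero = refl
  1^n≡1 (suc n) = trans (*-identityˡ _) (1^n≡1 n)

  x^n≢0 : ∀ {x} n → ¬ x ≡ 0# → ¬ x ^ n ≡ 0#
  x^n≢0 zero x≢0 = 1≢0
  x^n≢0 (suc n) x≢0 = x*y≢0 x≢0 (x^n≢0 n x≢0)

  m^k·1≡[m·1]^k : ∀ m k → (m ℕ.^ k) · 1# ≡ (m · 1#) ^ k
  m^k·1≡[m·1]^k m zero = +-identityʳ 1#
  m^k·1≡[m·1]^k m (suc k) = trans (×1-homo-* m (m ℕ.^ k)) (cong ((m · 1#) *_) (m^k·1≡[m·1]^k m k))

  ∏-≢0 : ∀ {k} (t : Fin k → Carrier) → (∀ i → ¬ t i ≡ 0#) → ¬ ∏.sum t ≡ 0#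
  ∏-≢0 {zero} t t≢0 = 1≢0
  ∏-≢0 {suc k} t t≢0 = x*y≢0 (t≢0 Fin.zero) (∏-≢0 (t ∘ Fin.suc) (t≢0 ∘ Fin.suc))

  ∏-single : ∀ {k} (t : Fin k → Carrier) j → (∀ i → ¬ i ≡ j → t i ≡ 1#) → ∏.sum t ≡ t j
  ∏-single {suc k} t Fin.zero t≡1 = begin
    t Fin.zero * ∏.sum (t ∘ Fin.suc)
      ≡⟨ cong (t Fin.zero *_) (trans (∏.sum-cong-≗ {k} (λ i → t≡1 (Fin.suc i) (λ ()))) (∏.sum-replicate-zero k)) ⟩
    t Fin.zero * 1#                    ≡⟨ *-identityʳ _ ⟩
    t Fin.zero                         ∎
  ∏-single {suc k} t (Fin.suc j) t≡1 = begin
    t Fin.zero * ∏.sum (t ∘ Fin.suc)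
      ≡⟨ cong₂ _*_ (t≡1 Fin.zero (λ ())) (∏-single (t ∘ Fin.suc) j (λ i i≢j → t≡1 (Fin.suc i) (i≢j ∘ Fin.suc-injective))) ⟩
    1# * t (Fin.suc j)                 ≡⟨ *-identityˡ _ ⟩
    t (Fin.suc j)                      ∎

module Polynomials (F : Field) where

  open FieldProperties F
  open ≡-Reasoning

  -- Polynomials are coefficient vectors, constant term first.
  eval : ∀ {m} → Vec Carrier m → Carrier → Carrier
  eval [] x = 0#
  eval (c ∷ cs) x = c + x * eval cs x

  divideByLinear : ∀ {m} → Carrier → Vec Carrier (suc m) → Vec Carrier m
  divideByLinear {zero} r (c ∷ []) = []
  divideByLinear {suc m} r (c ∷ cs) = eval cs r ∷ divideByLinear r cs

  eval-divideByLinear : ∀ {m} r x (f : Vec Carrier (suc m)) →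
    eval f x ≡ eval f r + (x - r) * eval (divideByLinear r f) x
  eval-divideByLinear {zero} r x (c ∷ []) =
    solve 3 (λ c x r → c :+ x :* con 0ℤ := (c :+ r :* con 0ℤ) :+ (x :- r) :* con 0ℤ) refl c x r
  eval-divideByLinear {suc m} r x (c ∷ cs) = begin
    c + x * eval cs x                                   ≡⟨ cong (λ z → c + x * z) (eval-divideByLinear r x cs) ⟩
    c + x * (eval cs r + (x - r) * eval q x)
      ≡⟨ solve 5 (λ c x r g h → c :+ x :* (g :+ (x :- r) :* h) := (c :+ r :* g) :+ (x :- r) :* (g :+ x :* h)) refl c x r (eval cs r) (eval q x) ⟩
    (c + r * eval cs r) + (x - r) * (eval cs r + x * eval q x) ∎
    where
    q : Vec Carrier m
    q = divideByLinear r cs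

  last-divideByLinear : ∀ {m} r (f : Vec Carrier (suc (suc m))) → last (divideByLinear r f) ≡ last f
  last-divideByLinear {zero} r (c ∷ d ∷ []) = trans (cong (d +_) (zeroʳ r)) (+-identityʳ d)
  last-divideByLinear {suc m} r (c ∷ cs) = last-divideByLinear r cs

  roots⇒last≡0 : ∀ {m} (f : Vec Carrier (suc m)) (r : Fin (suc m) → Carrier) →
    (∀ {i j} → r i ≡ r j → i ≡ j) → (∀ i → eval f (r i) ≡ 0#) → last f ≡ 0#
  roots⇒last≡0 {zero} (c ∷ []) r _ roots = trans (sym (trans (cong (c +_) (zeroʳ _)) (+-identityʳ c))) (roots Fin.zero)
  roots⇒last≡0 {suc m} f r r-injective roots =
    trans (sym (last-divideByLinear r₀ f))
          (roots⇒last≡0 (divideByLinear r₀ f) (r ∘ Fin.suc) (Fin.suc-injective ∘ r-injective) quotient-roots)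
    where
    r₀ : Carrier
    r₀ = r Fin.zero
    quotient-roots : ∀ i → eval (divideByLinear r₀ f) (r (Fin.suc i)) ≡ 0#
    quotient-roots i = *-cancelˡ-≡0 (λ rᵢ-r₀≡0 → Fin.0≢1+n (r-injective (sym (x-y≡0⇒x≡y rᵢ-r₀≡0)))) (begin
      (rᵢ - r₀) * eval q rᵢ                 ≡⟨ +-identityˡ _ ⟨
      0# + (rᵢ - r₀) * eval q rᵢ            ≡⟨ cong (_+ ((rᵢ - r₀) * eval q rᵢ)) (roots Fin.zero) ⟨
      eval f r₀ + (rᵢ - r₀) * eval q rᵢ     ≡⟨ eval-divideByLinear r₀ rᵢ f ⟨
      eval f rᵢ                             ≡⟨ roots (Fin.suc i) ⟩
      0#                                    ∎)
      where
      rᵢ : Carrier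
      rᵢ = r (Fin.suc i)
      q : Vec Carrier (suc m)
      q = divideByLinear r₀ f

  monomial : ∀ k → Vec Carrier (suc k)
  monomial zero = 1# ∷ []
  monomial (suc k) = 0# ∷ monomial k

  eval-monomial : ∀ k x → eval (monomial k) x ≡ x ^ k
  eval-monomial zero x = trans (cong (1# +_) (zeroʳ x)) (+-identityʳ 1#)
  eval-monomial (suc k) x = trans (+-identityˡ _) (cong (x *_) (eval-monomial k x))

  last-monomial : ∀ k → last (monomial k) ≡ 1#
  last-monomial zero = refl
  last-monomial (suc zero) = refl
  last-monomial (suc (suc k)) = last-monomial (suc k)

  X^[2+k]-X : ∀ k → Vec Carrier (3 ℕ.+ k)
  X^[2+k]-X k = 0# ∷ - 1# ∷ monomial k

  eval-X^[2+k]-X : ∀ k x → eval (X^[2+k]-X k) x ≡ x ^ (2 ℕ.+ k) - x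
  eval-X^[2+k]-X k x = begin
    0# + x * (- 1# + x * eval (monomial k) x)   ≡⟨ cong (λ z → 0# + x * (- 1# + x * z)) (eval-monomial k x) ⟩
    0# + x * (- 1# + x * x ^ k)                 ≡⟨ solve 2 (λ x y → con 0ℤ :+ x :* (:- con 1ℤ :+ x :* y) := x :* (x :* y) :- x) refl x (x ^ k) ⟩
    x * (x * x ^ k) - x                         ∎

module FiniteField (F : Field) {n : ℕ} (enumeration : Fin n ↔ Field.Carrier F) where

  open FieldProperties F
  open Polynomials F
  open Inverse enumeration using (to; from; strictlyInverseˡ; strictlyInverseʳ)
  open ≡-Reasoning

  infix 4 _≟_
  _≟_ : DecidableEquality Carrier
  x ≟ y with from x Fin.≟ from y
  ... | yes fx≡fy = yes (trans (sym (strictlyInverseˡ x)) (trans (cong to fx≡fy) (strictlyInverseˡ y)))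
  ... | no fx≢fy = no (λ x≡y → fx≢fy (cong from x≡y))

  to-injective : ∀ {i j} → to i ≡ to j → i ≡ j
  to-injective {i} {j} toi≡toj = trans (sym (strictlyInverseʳ i)) (trans (cong from toi≡toj) (strictlyInverseʳ j))

  module _ (M : CommutativeMonoid 0ℓ 0ℓ) where
    private
      module M = CommutativeMonoid M
    open Algebra.Properties.CommutativeMonoid.Sum M using (sum; sum-permute; sum-cong-≗)

    sum-reindex : (f : Carrier → M.Carrier) (h : Carrier ↔ Carrier) → sum (f ∘ to) M.≈ sum (f ∘ Inverse.to h ∘ to)
    sum-reindex f h = M.trans (sum-permute (f ∘ to) (↔-sym enumeration ↔-∘ (h ↔-∘ enumeration)))
      (M.reflexive (sum-cong-≗ {n} (λ i → cong f (strictlyInverseˡ (Inverse.to h (to i))))))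

  private
    module ∑ = Algebra.Properties.CommutativeMonoid.Sum +-commutativeMonoid

  -- Translation by 1 permutes F, so Σ x = Σ (x + 1) = Σ x + n · 1.
  n·1≡0 : n · 1# ≡ 0#
  n·1≡0 = begin
    n · 1#                            ≡⟨ solve 2 (λ s k → k := (s :+ k) :- s) refl S (n · 1#) ⟩
    (S + n · 1#) - S                  ≡⟨ cong (λ z → (S + z) - S) (∑.sum-replicate n) ⟨
    (S + ∑.sum {n} (λ _ → 1#)) - S    ≡⟨ cong (_- S) (∑.∑-distrib-+ to (λ _ → 1#)) ⟨
    ∑.sum (λ i → to i + 1#) - S       ≡⟨ cong (_- S) (sum-reindex +-commutativeMonoid id translation) ⟨
    S - S                             ≡⟨ x≡y⇒x-y≡0 refl ⟩
    0#                                ∎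
    where
    S : Carrier
    S = ∑.sum to
    translation : Carrier ↔ Carrier
    translation = mk↔ₛ′ (_+ 1#) (_- 1#)
      (solve 1 (λ x → x :- con 1ℤ :+ con 1ℤ := x) refl) (solve 1 (λ x → x :+ con 1ℤ :- con 1ℤ := x) refl)

  n≡p^m⇒p·1≡0 : ∀ {p m} → n ≡ p ℕ.^ m → p · 1# ≡ 0#
  n≡p^m⇒p·1≡0 {p} {m} n≡p^m = decidable-stable (p · 1# ≟ 0#) (λ p·1≢0 → x^n≢0 m p·1≢0 (begin
    (p · 1#) ^ m         ≡⟨ m^k·1≡[m·1]^k p m ⟨
    (p ℕ.^ m) · 1#       ≡⟨ cong (_· 1#) n≡p^m ⟨
    n · 1#               ≡⟨ n·1≡0 ⟩
    0#                   ∎))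

  nonzeroPart : Carrier → Carrier
  nonzeroPart x with x ≟ 0#
  ... | yes _ = 1#
  ... | no _ = x

  nonzeroPart≢0 : ∀ x → ¬ nonzeroPart x ≡ 0#
  nonzeroPart≢0 x with x ≟ 0#
  ... | yes _ = 1≢0
  ... | no x≢0 = x≢0

  lostFactor : Carrier → Carrier → Carrier
  lostFactor a x with x ≟ 0#
  ... | yes _ = a
  ... | no _ = 1#

  nonzeroPart-* : ∀ {a} → ¬ a ≡ 0# → ∀ x → a * nonzeroPart x ≡ nonzeroPart (a * x) * lostFactor a x
  nonzeroPart-* {a} a≢0 x with x ≟ 0# | (a * x) ≟ 0#
  ... | yes _    | yes _     = *-comm a 1#
  ... | yes refl | no ax≢0   = ⊥-elim (ax≢0 (zeroʳ a))
  ... | no x≢0   | yes ax≡0  = ⊥-elim (x*y≢0 a≢0 x≢0 ax≡0)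
  ... | no _     | no _      = sym (*-identityʳ (a * x))

  ∏-lostFactor : ∀ a → ∏.sum (lostFactor a ∘ to) ≡ a
  ∏-lostFactor a = trans (∏-single _ (from 0#) others≡1) (trans (cong (lostFactor a) (strictlyInverseˡ 0#)) at-0≡a)
    where
    at-0≡a : lostFactor a 0# ≡ a
    at-0≡a with 0# ≟ 0#
    ... | yes _ = refl
    ... | no 0≢0 = ⊥-elim (0≢0 refl)
    others≡1 : ∀ i → ¬ i ≡ from 0# → lostFactor a (to i) ≡ 1#
    others≡1 i i≢from0 with to i ≟ 0#
    ... | yes toi≡0 = ⊥-elim (i≢from0 (to-injective (trans toi≡0 (sym (strictlyInverseˡ 0#)))))
    ... | no _ = refl

  -- Multiplication by a ≠ 0 permutes F, so P = ∏ nonzeroPart x is also ∏ nonzeroPart (a x);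
  -- multiplying each factor by a instead loses exactly one factor a, at x = 0.
  x^n≡x : ∀ a → a ^ n ≡ a
  x^n≡x a with a ≟ 0#
  ... | yes refl = 0^m≡0 (from 0#)
    where
    0^m≡0 : ∀ {m} → Fin m → 0# ^ m ≡ 0#
    0^m≡0 {suc m} _ = zeroˡ (0# ^ m)
  ... | no a≢0 = x-y≡0⇒x≡y (*-cancelʳ-≡0 (∏-≢0 _ (nonzeroPart≢0 ∘ to)) (begin
    (a ^ n - a) * P                  ≡⟨ solve 3 (λ x y p → (x :- y) :* p := x :* p :- p :* y) refl (a ^ n) a P ⟩
    a ^ n * P - P * a                ≡⟨ cong (λ z → z - P * a) aⁿP≡Pa ⟩
    P * a - P * a                    ≡⟨ x≡y⇒x-y≡0 refl ⟩
    0#                               ∎))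
    where
    P : Carrier
    P = ∏.sum (nonzeroPart ∘ to)
    dilation : Carrier ↔ Carrier
    dilation = mk↔ₛ′ (a *_) (inv a *_) (λ x → trans (sym (*-assoc a (inv a) x)) (trans (cong (_* x) (inv-r a a≢0)) (*-identityˡ x)))
      (inv-cancelˡ a≢0)
    aⁿP≡Pa : a ^ n * P ≡ P * a
    aⁿP≡Pa = begin
      a ^ n * P                                                            ≡⟨ cong (_* P) (trans (^≡Exp^ a n) (sym (∏.sum-replicate n))) ⟩
      ∏.sum {n} (λ _ → a) * P                                              ≡⟨ ∏.∑-distrib-+ (λ _ → a) (nonzeroPart ∘ to) ⟨
      ∏.sum (λ i → a * nonzeroPart (to i))                                 ≡⟨ ∏.sum-cong-≗ {n} (nonzeroPart-* a≢0 ∘ to) ⟩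
      ∏.sum (λ i → nonzeroPart (a * to i) * lostFactor a (to i))           ≡⟨ ∏.∑-distrib-+ (nonzeroPart ∘ (a *_) ∘ to) (lostFactor a ∘ to) ⟩
      ∏.sum (nonzeroPart ∘ (a *_) ∘ to) * ∏.sum (lostFactor a ∘ to)
        ≡⟨ cong₂ _*_ (sym (sum-reindex *-commutativeMonoid nonzeroPart dilation)) (∏-lostFactor a) ⟩
      P * a                                                                ∎

  ∃x^m≢x : ∀ {m} → 2 ≤ m → m < n → ∃[ a ] ¬ a ^ m ≡ a
  ∃x^m≢x {suc (suc k)} (s≤s (s≤s _)) m<n =
    Data.Product.map to id (Fin.¬∀⟶∃¬ n (λ i → to i ^ suc (suc k) ≡ to i) (λ i → to i ^ suc (suc k) ≟ to i) not-all-fixed)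
    where
    r : Fin (suc (suc (suc k))) → Carrier
    r i = to (Fin.inject≤ i m<n)
    r-injective : ∀ {i j} → r i ≡ r j → i ≡ j
    r-injective {i} {j} ri≡rj = Fin.inject≤-injective m<n m<n i j (to-injective ri≡rj)
    not-all-fixed : ¬ (∀ i → to i ^ suc (suc k) ≡ to i)
    not-all-fixed all-fixed = 1≢0 (trans (sym (last-monomial k)) (roots⇒last≡0 (X^[2+k]-X k) r r-injective
      (λ i → trans (eval-X^[2+k]-X k (r i)) (x≡y⇒x-y≡0 (all-fixed (Fin.inject≤ i m<n))))))

2≤p : ∀ {p} → Prime p → 2 ≤ p
2≤p {p} p-prime = ℕ.nonTrivial⇒n>1 p {{prime⇒nonTrivial p-prime}}

prime∤m! : ∀ {p m} → Prime p → m < p → ¬ p ∣ m !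
prime∤m! {m = zero} p-prime _ p∣1 = ℕ.<⇒≢ (2≤p p-prime) (sym (∣1⇒≡1 p∣1))
prime∤m! {m = suc m} p-prime m<p p∣m! with euclidsLemma (suc m) (m !) p-prime p∣m!
... | inj₁ p∣1+m = ℕ.<⇒≱ m<p (∣⇒≤ p∣1+m)
... | inj₂ p∣m! = prime∤m! p-prime (ℕ.<-trans (ℕ.n<1+n m) m<p) p∣m!

nCk*[k!*[n∸k]!]≡n! : ∀ {n k} → k ≤ n → (n C k) ℕ.* (k ! ℕ.* (n ℕ.∸ k) !) ≡ n !
nCk*[k!*[n∸k]!]≡n! {n} {k} k≤n = trans (cong (ℕ._* (k ! ℕ.* (n ℕ.∸ k) !)) (nCk≡n!/k![n-k]! k≤n)) (m/n*n≡m (k![n∸k]!∣n! k≤n))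
  where
  instance _ = k ℕ.!* (n ℕ.∸ k) !≢0

n∣n! : ∀ n → .{{ℕ.NonZero n}} → n ∣ n !
n∣n! (suc n) = m∣m*n (n !)

p∣pCk : ∀ {p k} → Prime p → 0 < k → k < p → p ∣ p C k
p∣pCk {p} {k} p-prime 0<k k<p
  with euclidsLemma (p C k) (k ! ℕ.* (p ℕ.∸ k) !) p-prime
         (subst (p ∣_) (sym (nCk*[k!*[n∸k]!]≡n! (ℕ.<⇒≤ k<p))) (n∣n! p {{prime⇒nonZero p-prime}}))
... | inj₁ p∣pCk = p∣pCk
... | inj₂ p∣k!*[p∸k]! with euclidsLemma (k !) ((p ℕ.∸ k) !) p-prime p∣k!*[p∸k]!
...   | inj₁ p∣k! = ⊥-elim (prime∤m! p-prime k<p p∣k!)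
...   | inj₂ p∣[p∸k]! = ⊥-elim (prime∤m! p-prime (ℕ.∸-monoʳ-< 0<k (ℕ.<⇒≤ k<p)) p∣[p∸k]!)

module FreshmansDream {c ℓ} (S : CommutativeSemiring c ℓ) where

  open CommutativeSemiring S renaming (trans to ≈-trans)
  open Algebra.Properties.Semiring.Mult semiring using (×-assoc-*; ×-homo-1) renaming (_×_ to _·_)
  open Algebra.Properties.Monoid.Mult +-monoid using (×-assocˡ; ×-congʳ)
  open Algebra.Properties.Semiring.Exp semiring using (_^_; ^-congˡ; ^-assocʳ)
  open Algebra.Properties.Monoid.Sum +-monoid using (sum; sum-init-last; sum-cong-≋; sum-replicate-zero)
  open import Algebra.Properties.CommutativeSemiring.Binomial S using (theorem; binomialTerm)
  open import Relation.Binary.Reasoning.Setoid setoid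

  module _ {p : ℕ} (p-prime : Prime p) (p·1≈0 : p · 1# ≈ 0#) where

    [m*p]·x≈0 : ∀ m x → (m ℕ.* p) · x ≈ 0#
    [m*p]·x≈0 m x = begin
      (m ℕ.* p) · x       ≡⟨ cong (_· x) (ℕ.*-comm m p) ⟩
      (p ℕ.* m) · x       ≈⟨ ×-assocˡ x p m ⟨
      p · (m · x)         ≈⟨ ×-congʳ p (*-identityˡ (m · x)) ⟨
      p · (1# * (m · x))  ≈⟨ ×-assoc-* p 1# (m · x) ⟨
      (p · 1#) * (m · x)  ≈⟨ *-congʳ p·1≈0 ⟩
      0# * (m · x)        ≈⟨ zeroˡ (m · x) ⟩
      0#                  ∎

    ^p-homo-+ : ∀ x y → (x + y) ^ p ≈ x ^ p + y ^ p
    ^p-homo-+ x y with 2≤p p-prime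
    ... | s≤s (s≤s {n = k} _) = begin
      (x + y) ^ p                              ≈⟨ theorem p x y ⟩
      t Fin.zero + sum (t ∘ Fin.suc)           ≈⟨ +-congˡ (sum-init-last (t ∘ Fin.suc)) ⟩
      t Fin.zero + (sum (t ∘ Fin.suc ∘ Fin.inject₁) + t (Fin.suc (Fin.fromℕ (suc k))))
                                               ≈⟨ +-cong first (+-cong (≈-trans (sum-cong-≋ middle) (sum-replicate-zero (suc k))) final) ⟩
      y ^ p + (0# + x ^ p)                     ≈⟨ +-congˡ (+-identityˡ (x ^ p)) ⟩
      y ^ p + x ^ p                            ≈⟨ +-comm (y ^ p) (x ^ p) ⟩
      x ^ p + y ^ p                            ∎
      where
      t : Fin (suc p) → Carrier
      t = binomialTerm x y p
      first : t Fin.zero ≈ y ^ p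
      first = ≈-trans (×-homo-1 _) (*-identityˡ (y ^ p))
      final : t (Fin.suc (Fin.fromℕ (suc k))) ≈ x ^ p
      final = begin
        t (Fin.suc (Fin.fromℕ (suc k)))        ≡⟨ cong (λ j → (p C j) · (x ^ j * y ^ (p ℕ.∸ j))) (cong suc (Fin.toℕ-fromℕ (suc k))) ⟩
        (p C p) · (x ^ p * y ^ (p ℕ.∸ p))      ≡⟨ cong₂ (λ c j → c · (x ^ p * y ^ j)) (nCn≡1 p) (ℕ.n∸n≡0 p) ⟩
        1 · (x ^ p * 1#)                       ≈⟨ ×-homo-1 _ ⟩
        x ^ p * 1#                             ≈⟨ *-identityʳ (x ^ p) ⟩
        x ^ p                                  ∎
      middle : ∀ i → t (Fin.suc (Fin.inject₁ i)) ≈ 0#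
      middle i with p∣pCk p-prime (s≤s z≤n) (s≤s (ℕ.≤-trans (ℕ.≤-reflexive (cong suc (Fin.toℕ-inject₁ i))) (Fin.toℕ<n i)))
      ... | divides m pCj≡m*p = begin
        t (Fin.suc (Fin.inject₁ i))            ≡⟨ cong (_· xʲyᵖ⁻ʲ) pCj≡m*p ⟩
        (m ℕ.* p) · xʲyᵖ⁻ʲ                     ≈⟨ [m*p]·x≈0 m xʲyᵖ⁻ʲ ⟩
        0#                                     ∎
        where
        j : ℕ
        j = suc (Fin.toℕ (Fin.inject₁ i))
        xʲyᵖ⁻ʲ : Carrier
        xʲyᵖ⁻ʲ = x ^ j * y ^ (p ℕ.∸ j)

    ^pᵏ-homo-+ : ∀ k x y → (x + y) ^ (p ℕ.^ k) ≈ x ^ (p ℕ.^ k) + y ^ (p ℕ.^ k)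
    ^pᵏ-homo-+ zero x y = distribʳ 1# x y
    ^pᵏ-homo-+ (suc k) x y = begin
      (x + y) ^ (p ℕ.* p ℕ.^ k)                    ≈⟨ ^-assocʳ (x + y) p (p ℕ.^ k) ⟨
      ((x + y) ^ p) ^ (p ℕ.^ k)                    ≈⟨ ^-congˡ (p ℕ.^ k) (^p-homo-+ x y) ⟩
      (x ^ p + y ^ p) ^ (p ℕ.^ k)                  ≈⟨ ^pᵏ-homo-+ k (x ^ p) (y ^ p) ⟩
      (x ^ p) ^ (p ℕ.^ k) + (y ^ p) ^ (p ℕ.^ k)    ≈⟨ +-cong (^-assocʳ x p (p ℕ.^ k)) (^-assocʳ y p (p ℕ.^ k)) ⟩
      x ^ (p ℕ.* p ℕ.^ k) + y ^ (p ℕ.* p ℕ.^ k)    ∎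

record FrobeniusInvolution (F : Field) (q : ℕ) : Set where
  open Field F
  field
    ^q-homo-+ : ∀ x y → (x + y) ^ q ≡ x ^ q + y ^ q
    ^q-involutive : ∀ x → (x ^ q) ^ q ≡ x
    nonFixed : Carrier
    nonFixed^q≢nonFixed : ¬ nonFixed ^ q ≡ nonFixed

module HermitianGeometry (F : Field) (q : ℕ) (frobenius : FrobeniusInvolution F q)
  (_≟_ : DecidableEquality (Field.Carrier F)) where

  open FieldProperties F
  open Geometry F q
  open FrobeniusInvolution frobenius renaming (nonFixed to e; nonFixed^q≢nonFixed to e^q≢e)
  open ≡-Reasoning

  conj : Carrier → Carrier
  conj x = x ^ q

  N : Carrier → Carrier
  N x = x * conj x

  conj-+ : ∀ x y → conj (x + y) ≡ conj x + conj y
  conj-+ = ^q-homo-+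

  conj-* : ∀ x y → conj (x * y) ≡ conj x * conj y
  conj-* x y = ^-distrib-* x y q

  conj-involutive : ∀ x → conj (conj x) ≡ x
  conj-involutive = ^q-involutive

  conj-1 : conj 1# ≡ 1#
  conj-1 = 1^n≡1 q

  conj-0 : conj 0# ≡ 0#
  conj-0 = begin
    conj 0#                           ≡⟨ solve 1 (λ z → z := (z :+ z) :- z) refl (conj 0#) ⟩
    (conj 0# + conj 0#) - conj 0#     ≡⟨ cong (_- conj 0#) (conj-+ 0# 0#) ⟨
    conj (0# + 0#) - conj 0#          ≡⟨ cong (λ z → conj z - conj 0#) (+-identityʳ 0#) ⟩
    conj 0# - conj 0#                 ≡⟨ x≡y⇒x-y≡0 refl ⟩
    0#                                ∎

  conj-neg : ∀ x → conj (- x) ≡ - conj x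
  conj-neg x = begin
    conj (- x)                        ≡⟨ solve 2 (λ a b → a := (a :+ b) :- b) refl (conj (- x)) (conj x) ⟩
    (conj (- x) + conj x) - conj x    ≡⟨ cong (_- conj x) (conj-+ (- x) x) ⟨
    conj (- x + x) - conj x           ≡⟨ cong (λ z → conj z - conj x) (solve 1 (λ x → :- x :+ x := con 0ℤ) refl x) ⟩
    conj 0# - conj x                  ≡⟨ cong (_- conj x) conj-0 ⟩
    0# - conj x                       ≡⟨ +-identityˡ _ ⟩
    - conj x                          ∎

  conj-linear : ∀ l m x y → conj (l * x + m * y) ≡ conj l * conj x + conj m * conj y
  conj-linear l m x y = trans (conj-+ (l * x) (m * y)) (cong₂ _+_ (conj-* l x) (conj-* m y))

  conj≢0 : ∀ {x} → ¬ x ≡ 0# → ¬ conj x ≡ 0#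
  conj≢0 {x} x≢0 conjx≡0 = x≢0 (trans (sym (conj-involutive x)) (trans (cong conj conjx≡0) conj-0))

  N-* : ∀ x y → N (x * y) ≡ N x * N y
  N-* x y = begin
    (x * y) * conj (x * y)        ≡⟨ cong ((x * y) *_) (conj-* x y) ⟩
    (x * y) * (conj x * conj y)   ≡⟨ solve 4 (λ x y x̄ ȳ → (x :* y) :* (x̄ :* ȳ) := (x :* x̄) :* (y :* ȳ)) refl x y (conj x) (conj y) ⟩
    N x * N y                     ∎

  N≡0⇒x≡0 : ∀ {x} → N x ≡ 0# → x ≡ 0#
  N≡0⇒x≡0 {x} Nx≡0 = decidable-stable (x ≟ 0#) (λ x≢0 → x*y≢0 x≢0 (conj≢0 x≢0) Nx≡0)

  e≢0 : ¬ e ≡ 0#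
  e≢0 e≡0 = e^q≢e (trans (cong conj e≡0) (trans conj-0 (sym e≡0)))

  Qform : V4 → Carrier
  Qform v = α v * δ v - β v * γ v

  Hform : V4 → Carrier
  Hform v = N (α v) - N (β v) - N (γ v) + N (δ v)

  v4-cong : ∀ {a a′ b b′ c c′ d d′} → a ≡ a′ → b ≡ b′ → c ≡ c′ → d ≡ d′ → v4 a b c d ≡ v4 a′ b′ c′ d′
  v4-cong refl refl refl refl = refl

  scale-scale : ∀ l c v → scale l (scale c v) ≡ scale (l * c) v
  scale-scale l c v = v4-cong (sym (*-assoc l c _)) (sym (*-assoc l c _)) (sym (*-assoc l c _)) (sym (*-assoc l c _))

  scale-1 : ∀ v → scale 1# v ≡ v
  scale-1 v = v4-cong (*-identityˡ _) (*-identityˡ _) (*-identityˡ _) (*-identityˡ _)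

  samePoint-scale : ∀ {c₁ c₂} v → ¬ c₁ ≡ 0# → ¬ c₂ ≡ 0# → SamePoint (scale c₂ v) (scale c₁ v)
  samePoint-scale {c₁} {c₂} v c₁≢0 c₂≢0 = c₂ * inv c₁ , x*y≢0 c₂≢0 (inv≢0 c₁≢0) , (begin
    scale c₂ v                          ≡⟨ cong (λ c → scale c v) (inv-cancelʳ c₁≢0 c₂) ⟨
    scale ((c₂ * inv c₁) * c₁) v        ≡⟨ scale-scale _ c₁ v ⟨
    scale (c₂ * inv c₁) (scale c₁ v)    ∎)

  onSpan-left : ∀ u w → OnSpan u w u
  onSpan-left u w = 1# , 0# , v4-cong (x≡1x+0y (α u) (α w)) (x≡1x+0y (β u) (β w)) (x≡1x+0y (γ u) (γ w)) (x≡1x+0y (δ u) (δ w))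
    where
    x≡1x+0y : ∀ x y → x ≡ 1# * x + 0# * y
    x≡1x+0y = solve 2 (λ x y → x := con 1ℤ :* x :+ con 0ℤ :* y) refl

  onSpan-right : ∀ u w → OnSpan u w w
  onSpan-right u w = 0# , 1# , v4-cong (y≡0x+1y (α u) (α w)) (y≡0x+1y (β u) (β w)) (y≡0x+1y (γ u) (γ w)) (y≡0x+1y (δ u) (δ w))
    where
    y≡0x+1y : ∀ x y → y ≡ 0# * x + 1# * y
    y≡0x+1y = solve 2 (λ x y → y := con 0ℤ :* x :+ con 1ℤ :* y) refl

  σ-+ : ∀ a₁ b₁ a₂ b₂ → add (σ a₁ b₁) (σ a₂ b₂) ≡ σ (a₁ + a₂) (b₁ + b₂)
  σ-+ a₁ b₁ a₂ b₂ = v4-cong refl refl (sym (conj-+ b₁ b₂)) (sym (conj-+ a₁ a₂))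

  σ-neg : ∀ a b → σ (- a) (- b) ≡ scale (- 1#) (σ a b)
  σ-neg a b = v4-cong (-x≡-1*x a) (-x≡-1*x b) (trans (conj-neg b) (-x≡-1*x (conj b))) (trans (conj-neg a) (-x≡-1*x (conj a)))
    where
    -x≡-1*x : ∀ x → - x ≡ - 1# * x
    -x≡-1*x = solve 1 (λ x → :- x := :- con 1ℤ :* x) refl

  InΣ-σ : ∀ {a} b → ¬ a ≡ 0# → InΣ (σ a b)
  InΣ-σ {a} b a≢0 = (λ (a≡0 , _) → a≢0 a≡0) , a , b , 1# , 1≢0 , sym (scale-1 (σ a b))

  Qform-scale : ∀ c v → Qform (scale c v) ≡ (c * c) * Qform v
  Qform-scale c v = solve 5 (λ c a b g d → (c :* a) :* (c :* d) :- (c :* b) :* (c :* g) := (c :* c) :* (a :* d :- b :* g))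
    refl c (α v) (β v) (γ v) (δ v)

  Hform-scale : ∀ c v → Hform (scale c v) ≡ N c * Hform v
  Hform-scale c v = begin
    N (c * α v) - N (c * β v) - N (c * γ v) + N (c * δ v)
      ≡⟨ cong₂ _+_ (cong₂ _-_ (cong₂ _-_ (N-* c (α v)) (N-* c (β v))) (N-* c (γ v))) (N-* c (δ v)) ⟩
    N c * N (α v) - N c * N (β v) - N c * N (γ v) + N c * N (δ v)
      ≡⟨ solve 5 (λ n a b g d → n :* a :- n :* b :- n :* g :+ n :* d := n :* (a :- b :- g :+ d)) refl (N c) (N (α v)) (N (β v)) (N (γ v)) (N (δ v)) ⟩
    N c * Hform v ∎

  Hform-σ : ∀ a b → Hform (σ a b) ≡ Qform (σ a b) + Qform (σ a b)
  Hform-σ a b = begin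
    N a - N b - conj b * conj (conj b) + conj a * conj (conj a)
      ≡⟨ cong₂ (λ x y → N a - N b - conj b * x + conj a * y) (conj-involutive b) (conj-involutive a) ⟩
    N a - N b - conj b * b + conj a * a
      ≡⟨ solve 4 (λ a b ā b̄ → a :* ā :- b :* b̄ :- b̄ :* b :+ ā :* a := (a :* ā :- b :* b̄) :+ (a :* ā :- b :* b̄)) refl a b (conj a) (conj b) ⟩
    Qform (σ a b) + Qform (σ a b) ∎

  InQ+-scale⁻¹ : ∀ {c} v → ¬ c ≡ 0# → InQ+ (scale c v) → InQ+ v
  InQ+-scale⁻¹ {c} v c≢0 Q = *-cancelˡ-≡0 (x*y≢0 c≢0 c≢0) (trans (sym (Qform-scale c v)) Q)

  InQ0⇒InH : ∀ {v} → InQ0 v → InH v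
  InQ0⇒InH ((_ , a , b , c , c≢0 , refl) , Q) = begin
    Hform (scale c (σ a b))                        ≡⟨ Hform-scale c (σ a b) ⟩
    N c * Hform (σ a b)                            ≡⟨ cong (N c *_) (Hform-σ a b) ⟩
    N c * (Qform (σ a b) + Qform (σ a b))          ≡⟨ cong (λ z → N c * (z + z)) (InQ+-scale⁻¹ (σ a b) c≢0 Q) ⟩
    N c * (0# + 0#)                                ≡⟨ solve 1 (λ n → n :* (con 0ℤ :+ con 0ℤ) := con 0ℤ) refl (N c) ⟩
    0#                                             ∎

  herm : Carrier → Carrier → Carrier → Carrier → Carrier
  herm a₁ b₁ a₂ b₂ = a₁ * conj a₂ - b₁ * conj b₂

  combination : Carrier → Carrier → Carrier → Carrier → Carrier → Carrier → V4
  combination l m a₁ b₁ a₂ b₂ = add (scale l (σ a₁ b₁)) (scale m (σ a₂ b₂))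

  Qform-combination : ∀ l m a₁ b₁ a₂ b₂ → Qform (combination l m a₁ b₁ a₂ b₂) ≡
    (l * l) * herm a₁ b₁ a₁ b₁ + (m * m) * herm a₂ b₂ a₂ b₂ + (l * m) * (herm a₁ b₁ a₂ b₂ + herm a₂ b₂ a₁ b₁)
  Qform-combination l m a₁ b₁ a₂ b₂ = solve 10 (λ l m a₁ ā₁ b₁ b̄₁ a₂ ā₂ b₂ b̄₂ →
      (l :* a₁ :+ m :* a₂) :* (l :* ā₁ :+ m :* ā₂) :- (l :* b₁ :+ m :* b₂) :* (l :* b̄₁ :+ m :* b̄₂)
    := (l :* l) :* (a₁ :* ā₁ :- b₁ :* b̄₁) :+ (m :* m) :* (a₂ :* ā₂ :- b₂ :* b̄₂)
       :+ (l :* m) :* ((a₁ :* ā₂ :- b₁ :* b̄₂) :+ (a₂ :* ā₁ :- b₂ :* b̄₁)))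
    refl l m a₁ (conj a₁) b₁ (conj b₁) a₂ (conj a₂) b₂ (conj b₂)

  Hform-combination : ∀ l m a₁ b₁ a₂ b₂ → Hform (combination l m a₁ b₁ a₂ b₂) ≡
    (l * conj l) * (herm a₁ b₁ a₁ b₁ + herm a₁ b₁ a₁ b₁) + (m * conj m) * (herm a₂ b₂ a₂ b₂ + herm a₂ b₂ a₂ b₂)
      + (l * conj m + m * conj l) * (herm a₁ b₁ a₂ b₂ + herm a₂ b₂ a₁ b₁)
  Hform-combination l m a₁ b₁ a₂ b₂ = begin
    N (l * a₁ + m * a₂) - N (l * b₁ + m * b₂) - N (l * conj b₁ + m * conj b₂) + N (l * conj a₁ + m * conj a₂)
      ≡⟨ cong₂ _+_ (cong₂ _-_ (cong₂ _-_ (N-linear a₁ a₂) (N-linear b₁ b₂)) (N-linear-conj b₁ b₂)) (N-linear-conj a₁ a₂) ⟩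
    (l * a₁ + m * a₂) * (l̄ * conj a₁ + m̄ * conj a₂) - (l * b₁ + m * b₂) * (l̄ * conj b₁ + m̄ * conj b₂)
      - (l * conj b₁ + m * conj b₂) * (l̄ * b₁ + m̄ * b₂) + (l * conj a₁ + m * conj a₂) * (l̄ * a₁ + m̄ * a₂)
      ≡⟨ solve 12 (λ l l̄ m m̄ a₁ ā₁ b₁ b̄₁ a₂ ā₂ b₂ b̄₂ →
           (l :* a₁ :+ m :* a₂) :* (l̄ :* ā₁ :+ m̄ :* ā₂) :- (l :* b₁ :+ m :* b₂) :* (l̄ :* b̄₁ :+ m̄ :* b̄₂)
             :- (l :* b̄₁ :+ m :* b̄₂) :* (l̄ :* b₁ :+ m̄ :* b₂) :+ (l :* ā₁ :+ m :* ā₂) :* (l̄ :* a₁ :+ m̄ :* a₂)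
         := (l :* l̄) :* ((a₁ :* ā₁ :- b₁ :* b̄₁) :+ (a₁ :* ā₁ :- b₁ :* b̄₁))
             :+ (m :* m̄) :* ((a₂ :* ā₂ :- b₂ :* b̄₂) :+ (a₂ :* ā₂ :- b₂ :* b̄₂))
             :+ (l :* m̄ :+ m :* l̄) :* ((a₁ :* ā₂ :- b₁ :* b̄₂) :+ (a₂ :* ā₁ :- b₂ :* b̄₁)))
         refl l l̄ m m̄ a₁ (conj a₁) b₁ (conj b₁) a₂ (conj a₂) b₂ (conj b₂) ⟩
    _ ∎
    where
    l̄ : Carrier
    l̄ = conj l
    m̄ : Carrier
    m̄ = conj m
    N-linear : ∀ x y → N (l * x + m * y) ≡ (l * x + m * y) * (l̄ * conj x + m̄ * conj y)
    N-linear x y = cong ((l * x + m * y) *_) (conj-linear l m x y)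
    N-linear-conj : ∀ x y → N (l * conj x + m * conj y) ≡ (l * conj x + m * conj y) * (l̄ * x + m̄ * y)
    N-linear-conj x y = trans (N-linear (conj x) (conj y))
      (cong₂ (λ s t → (l * conj x + m * conj y) * (l̄ * s + m̄ * t)) (conj-involutive x) (conj-involutive y))

  combination-InQ+×InH : ∀ {l m a₁ b₁ a₂ b₂} → herm a₁ b₁ a₁ b₁ ≡ 0# → herm a₂ b₂ a₂ b₂ ≡ 0# →
    herm a₁ b₁ a₂ b₂ + herm a₂ b₂ a₁ b₁ ≡ 0# → InQ+ (combination l m a₁ b₁ a₂ b₂) × InH (combination l m a₁ b₁ a₂ b₂)
  combination-InQ+×InH {l} {m} {a₁} {b₁} {a₂} {b₂} h₁₁≡0 h₂₂≡0 h₁₂+h₂₁≡0 =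
    trans (Qform-combination l m a₁ b₁ a₂ b₂) (begin
      (l * l) * h₁₁ + (m * m) * h₂₂ + (l * m) * h₁₂+h₂₁
        ≡⟨ cong₂ _+_ (cong₂ _+_ (cong ((l * l) *_) h₁₁≡0) (cong ((m * m) *_) h₂₂≡0)) (cong ((l * m) *_) h₁₂+h₂₁≡0) ⟩
      (l * l) * 0# + (m * m) * 0# + (l * m) * 0#
        ≡⟨ solve 3 (λ x y z → x :* con 0ℤ :+ y :* con 0ℤ :+ z :* con 0ℤ := con 0ℤ) refl _ _ _ ⟩
      0# ∎) ,
    trans (Hform-combination l m a₁ b₁ a₂ b₂) (begin
      (l * conj l) * (h₁₁ + h₁₁) + (m * conj m) * (h₂₂ + h₂₂) + (l * conj m + m * conj l) * h₁₂+h₂₁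
        ≡⟨ cong₂ _+_ (cong₂ _+_ (cong (λ h → (l * conj l) * (h + h)) h₁₁≡0) (cong (λ h → (m * conj m) * (h + h)) h₂₂≡0))
                     (cong ((l * conj m + m * conj l) *_) h₁₂+h₂₁≡0) ⟩
      (l * conj l) * (0# + 0#) + (m * conj m) * (0# + 0#) + (l * conj m + m * conj l) * 0#
        ≡⟨ solve 3 (λ x y z → x :* (con 0ℤ :+ con 0ℤ) :+ y :* (con 0ℤ :+ con 0ℤ) :+ z :* con 0ℤ := con 0ℤ) refl _ _ _ ⟩
      0# ∎)
    where
    h₁₁ : Carrier
    h₁₁ = herm a₁ b₁ a₁ b₁
    h₂₂ : Carrier
    h₂₂ = herm a₂ b₂ a₂ b₂
    h₁₂+h₂₁ : Carrier
    h₁₂+h₂₁ = herm a₁ b₁ a₂ b₂ + herm a₂ b₂ a₁ b₁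

  herm-+ : ∀ a₁ b₁ a₂ b₂ → herm (a₁ + a₂) (b₁ + b₂) (a₁ + a₂) (b₁ + b₂) ≡
    herm a₁ b₁ a₁ b₁ + herm a₂ b₂ a₂ b₂ + (herm a₁ b₁ a₂ b₂ + herm a₂ b₂ a₁ b₁)
  herm-+ a₁ b₁ a₂ b₂ = begin
    (a₁ + a₂) * conj (a₁ + a₂) - (b₁ + b₂) * conj (b₁ + b₂)
      ≡⟨ cong₂ (λ s t → (a₁ + a₂) * s - (b₁ + b₂) * t) (conj-+ a₁ a₂) (conj-+ b₁ b₂) ⟩
    (a₁ + a₂) * (conj a₁ + conj a₂) - (b₁ + b₂) * (conj b₁ + conj b₂)
      ≡⟨ solve 8 (λ a₁ ā₁ b₁ b̄₁ a₂ ā₂ b₂ b̄₂ →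
           (a₁ :+ a₂) :* (ā₁ :+ ā₂) :- (b₁ :+ b₂) :* (b̄₁ :+ b̄₂)
         := (a₁ :* ā₁ :- b₁ :* b̄₁) :+ (a₂ :* ā₂ :- b₂ :* b̄₂) :+ ((a₁ :* ā₂ :- b₁ :* b̄₂) :+ (a₂ :* ā₁ :- b₂ :* b̄₁)))
         refl a₁ (conj a₁) b₁ (conj b₁) a₂ (conj a₂) b₂ (conj b₂) ⟩
    _ ∎

  -- herm vanishes at each spanning point, and at their sum (a point of Σ on the Baer subline), so the
  -- mixed terms cancel as well.
  onExtendedGenerator⇒InQ+×InH : ∀ {v} → OnExtendedGenerator v → InQ+ v × InH v
  onExtendedGenerator⇒InQ+×InH
    (u , w , (Σu@(_ , a₁ , b₁ , c₁ , c₁≢0 , refl) , Σw@(_ , a₂ , b₂ , c₂ , c₂≢0 , refl) , w≉u , sublineInQ+) , l , m , refl)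
    = subst (λ v → InQ+ v × InH v) (sym (cong₂ add (scale-scale l c₁ _) (scale-scale m c₂ _)))
        (combination-InQ+×InH h₁₁≡0 h₂₂≡0 h₁₂+h₂₁≡0)
    where
    h₁₁≡0 : herm a₁ b₁ a₁ b₁ ≡ 0#
    h₁₁≡0 = InQ+-scale⁻¹ (σ a₁ b₁) c₁≢0 (sublineInQ+ u Σu (onSpan-left u w))
    h₂₂≡0 : herm a₂ b₂ a₂ b₂ ≡ 0#
    h₂₂≡0 = InQ+-scale⁻¹ (σ a₂ b₂) c₂≢0 (sublineInQ+ w Σw (onSpan-right u w))
    unscale : ∀ {c} s → ¬ c ≡ 0# → scale (inv c) (scale c s) ≡ s
    unscale {c} s c≢0 = trans (scale-scale (inv c) c s) (trans (cong (λ k → scale k s) (inv-l c≢0)) (scale-1 s))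
    x : V4
    x = add (scale (inv c₁) u) (scale (inv c₂) w)
    x≡σ : x ≡ σ (a₁ + a₂) (b₁ + b₂)
    x≡σ = trans (cong₂ add (unscale (σ a₁ b₁) c₁≢0) (unscale (σ a₂ b₂) c₂≢0)) (σ-+ a₁ b₁ a₂ b₂)
    x≢0 : Nonzero x
    x≢0 (αx≡0 , βx≡0 , _) = w≉u (subst (λ s → SamePoint (scale c₂ s) u) (sym σ₂≡-σ₁)
        (subst (λ s → SamePoint s u) (sym (scale-scale c₂ (- 1#) (σ a₁ b₁)))
          (samePoint-scale (σ a₁ b₁) c₁≢0 (x*y≢0 c₂≢0 -1≢0))))
      where
      σ₂≡-σ₁ : σ a₂ b₂ ≡ scale (- 1#) (σ a₁ b₁)
      σ₂≡-σ₁ = trans (cong₂ σ (x+y≡0⇒y≡-x (trans (sym (cong α x≡σ)) αx≡0)) (x+y≡0⇒y≡-x (trans (sym (cong β x≡σ)) βx≡0)))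
                     (σ-neg a₁ b₁)
    Σx : InΣ x
    Σx = x≢0 , a₁ + a₂ , b₁ + b₂ , 1# , 1≢0 , trans x≡σ (sym (scale-1 _))
    h₁₂+h₂₁≡0 : herm a₁ b₁ a₂ b₂ + herm a₂ b₂ a₁ b₁ ≡ 0#
    h₁₂+h₂₁≡0 = begin
      h₁₂+h₂₁                                          ≡⟨ solve 1 (λ h → h := con 0ℤ :+ con 0ℤ :+ h) refl h₁₂+h₂₁ ⟩
      0# + 0# + h₁₂+h₂₁                                ≡⟨ cong₂ (λ s t → s + t + h₁₂+h₂₁) h₁₁≡0 h₂₂≡0 ⟨
      herm a₁ b₁ a₁ b₁ + herm a₂ b₂ a₂ b₂ + h₁₂+h₂₁    ≡⟨ herm-+ a₁ b₁ a₂ b₂ ⟨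
      herm (a₁ + a₂) (b₁ + b₂) (a₁ + a₂) (b₁ + b₂)     ≡⟨ subst InQ+ x≡σ (sublineInQ+ x Σx (inv c₁ , inv c₂ , refl)) ⟩
      0#                                               ∎
      where
      h₁₂+h₂₁ : Carrier
      h₁₂+h₂₁ = herm a₁ b₁ a₂ b₂ + herm a₂ b₂ a₁ b₁

  NormOne : Carrier → Set
  NormOne ω = N ω ≡ 1#

  -- v lies on the line L ω = {(s, t, ω s, ω t)}, which is contained in Q⁺.
  OnL : Carrier → V4 → Set
  OnL ω v = γ v ≡ ω * α v × δ v ≡ ω * β v

  onL-add : ∀ {ω x y} l m → OnL ω x → OnL ω y → OnL ω (add (scale l x) (scale m y))
  onL-add {ω} l m (γx , δx) (γy , δy) = linear γx γy , linear δx δy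
    where
    linear : ∀ {a b c d} → c ≡ ω * a → d ≡ ω * b → l * c + m * d ≡ ω * (l * a + m * b)
    linear {a} {b} refl refl = solve 5 (λ ω l m a b → l :* (ω :* a) :+ m :* (ω :* b) := ω :* (l :* a :+ m :* b)) refl ω l m a b

  onL⇒InQ+ : ∀ {ω v} → OnL ω v → InQ+ v
  onL⇒InQ+ {ω} {v} (γv , δv) = begin
    α v * δ v - β v * γ v               ≡⟨ cong₂ (λ d c → α v * d - β v * c) δv γv ⟩
    α v * (ω * β v) - β v * (ω * α v)   ≡⟨ solve 3 (λ ω a b → a :* (ω :* b) :- b :* (ω :* a) := con 0ℤ) refl ω (α v) (β v) ⟩
    0#                                  ∎

  onL-β : ∀ {ω v} → NormOne ω → OnL ω v → β v ≡ conj ω * δ v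
  onL-β {ω} {v} Nω≡1 (_ , δv) = begin
    β v                    ≡⟨ *-identityˡ (β v) ⟨
    1# * β v               ≡⟨ cong (_* β v) Nω≡1 ⟨
    (ω * conj ω) * β v     ≡⟨ solve 3 (λ ω ω̄ b → (ω :* ω̄) :* b := ω̄ :* (ω :* b)) refl ω (conj ω) (β v) ⟩
    conj ω * (ω * β v)     ≡⟨ cong (conj ω *_) δv ⟨
    conj ω * δ v           ∎

  onL-≡ : ∀ {ω x y} → NormOne ω → OnL ω x → OnL ω y → α x ≡ α y → δ x ≡ δ y → x ≡ y
  onL-≡ {ω} Nω≡1 onLx@(γx , _) onLy@(γy , _) αx≡αy δx≡δy = v4-cong αx≡αy
    (trans (onL-β Nω≡1 onLx) (trans (cong (conj ω *_) δx≡δy) (sym (onL-β Nω≡1 onLy))))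
    (trans γx (trans (cong (ω *_) αx≡αy) (sym γy)))
    δx≡δy

  σ-onL : ∀ {ω} → NormOne ω → ∀ a → OnL ω (σ a (conj (ω * a)))
  σ-onL {ω} Nω≡1 a = conj-involutive (ω * a) , (begin
    conj a                        ≡⟨ *-identityˡ (conj a) ⟨
    1# * conj a                   ≡⟨ cong (_* conj a) Nω≡1 ⟨
    (ω * conj ω) * conj a         ≡⟨ *-assoc ω (conj ω) (conj a) ⟩
    ω * (conj ω * conj a)         ≡⟨ cong (ω *_) (conj-* ω a) ⟨
    ω * conj (ω * a)              ∎)

  spanning-coefficients : ∀ s r → ∃[ l ] ∃[ m ] (l * 1# + m * e ≡ s × l * conj 1# + m * conj e ≡ r)
  spanning-coefficients s r = l , m , α-eq , δ-eq
    where
    d : Carrier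
    d = conj e - e
    d≢0 : ¬ d ≡ 0#
    d≢0 d≡0 = e^q≢e (x-y≡0⇒x≡y d≡0)
    m : Carrier
    m = (r - s) * inv d
    l : Carrier
    l = s - m * e
    α-eq : l * 1# + m * e ≡ s
    α-eq = solve 3 (λ s m e → (s :- m :* e) :* con 1ℤ :+ m :* e := s) refl s m e
    δ-eq : l * conj 1# + m * conj e ≡ r
    δ-eq = begin
      l * conj 1# + m * conj e          ≡⟨ cong (λ z → l * z + m * conj e) conj-1 ⟩
      (s - m * e) * 1# + m * conj e     ≡⟨ solve 4 (λ s m e ē → (s :- m :* e) :* con 1ℤ :+ m :* ē := s :+ m :* (ē :- e)) refl s m e (conj e) ⟩
      s + m * d                         ≡⟨ cong (s +_) (inv-cancelʳ d≢0 (r - s)) ⟩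
      s + (r - s)                       ≡⟨ solve 2 (λ s r → s :+ (r :- s) := r) refl s r ⟩
      r                                 ∎

  onL⇒onExtendedGenerator : ∀ {ω v} → NormOne ω → OnL ω v → OnExtendedGenerator v
  onL⇒onExtendedGenerator {ω} {v} Nω≡1 onLv =
    u , w , (InΣ-σ _ 1≢0 , InΣ-σ _ e≢0 , w≉u , sublineInQ+) , l , m , v≡lu+mw
    where
    u : V4
    u = σ 1# (conj (ω * 1#))
    w : V4
    w = σ e (conj (ω * e))
    onL-span : ∀ l m → OnL ω (add (scale l u) (scale m w))
    onL-span l m = onL-add l m (σ-onL Nω≡1 1#) (σ-onL Nω≡1 e)
    w≉u : ¬ SamePoint w u
    w≉u (c , _ , w≡cu) = e^q≢e (begin
      conj e          ≡⟨ cong δ w≡cu ⟩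
      c * conj 1#     ≡⟨ cong (c *_) conj-1 ⟩
      c * 1#          ≡⟨ cong α w≡cu ⟨
      e               ∎)
    sublineInQ+ : ∀ x → InΣ x → OnSpan u w x → InQ+ x
    sublineInQ+ x _ (l , m , refl) = onL⇒InQ+ (onL-span l m)
    coefficients : ∃[ l ] ∃[ m ] (l * 1# + m * e ≡ α v × l * conj 1# + m * conj e ≡ δ v)
    coefficients = spanning-coefficients (α v) (δ v)
    l : Carrier
    l = proj₁ coefficients
    m : Carrier
    m = proj₁ (proj₂ coefficients)
    v≡lu+mw : v ≡ add (scale l u) (scale m w)
    v≡lu+mw = onL-≡ Nω≡1 onLv (onL-span l m) (sym (proj₁ (proj₂ (proj₂ coefficients)))) (sym (proj₂ (proj₂ (proj₂ coefficients))))

  -- Exchanging β and γ preserves Q⁺, H and Σ, and maps the lines L ω to the lines {(s, ω s, t, ω t)}.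
  swap : V4 → V4
  swap v = v4 (α v) (γ v) (β v) (δ v)

  InΣ-swap : ∀ {v} → InΣ v → InΣ (swap v)
  InΣ-swap (v≢0 , a , b , c , c≢0 , refl) =
    (λ (α≡0 , γ≡0 , β≡0 , δ≡0) → v≢0 (α≡0 , β≡0 , γ≡0 , δ≡0)) ,
    a , conj b , c , c≢0 , cong (λ z → scale c (v4 a (conj b) z (conj a))) (sym (conj-involutive b))

  InQ+-swap⁻¹ : ∀ {v} → InQ+ (swap v) → InQ+ v
  InQ+-swap⁻¹ {v} Q = trans (cong (λ z → α v * δ v - z) (*-comm (β v) (γ v))) Q

  onExtendedGenerator-swap : ∀ {v} → OnExtendedGenerator v → OnExtendedGenerator (swap v)
  onExtendedGenerator-swap (u , w , (Σu , Σw , w≉u , sublineInQ+) , l , m , refl) =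
    swap u , swap w ,
    (InΣ-swap Σu , InΣ-swap Σw , (λ (c , c≢0 , w≡cu) → w≉u (c , c≢0 , cong swap w≡cu)) ,
     λ x Σx (l′ , m′ , x≡) → InQ+-swap⁻¹ (sublineInQ+ (swap x) (InΣ-swap Σx) (l′ , m′ , cong swap x≡))) ,
    l , m , refl

  NormOne-ratio : ∀ {a b} → ¬ a ≡ 0# → N b ≡ N a → NormOne (b * inv a)
  NormOne-ratio {a} {b} a≢0 Nb≡Na = begin
    N (b * inv a)         ≡⟨ N-* b (inv a) ⟩
    N b * N (inv a)       ≡⟨ cong (_* N (inv a)) Nb≡Na ⟩
    N a * N (inv a)       ≡⟨ N-* a (inv a) ⟨
    N (a * inv a)         ≡⟨ cong N (inv-r a a≢0) ⟩
    1# * conj 1#          ≡⟨ trans (*-identityˡ _) conj-1 ⟩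
    1#                    ∎

  ad-bc≡0⇒d≡ : ∀ {a b c d} → ¬ a ≡ 0# → a * d - b * c ≡ 0# → d ≡ inv a * (b * c)
  ad-bc≡0⇒d≡ {a} {b} {c} {d} a≢0 Q = trans (sym (inv-cancelˡ a≢0 d)) (cong (inv a *_) (x-y≡0⇒x≡y Q))

  [X-Y][X-Z]≡0 : ∀ {X Y Z W} → X - Y - Z + W ≡ 0# → X * W ≡ Y * Z → (X - Y) * (X - Z) ≡ 0#
  [X-Y][X-Z]≡0 {X} {Y} {Z} {W} H XW≡YZ = begin
    (X - Y) * (X - Z)                      ≡⟨ solve 4 (λ X Y Z W → (X :- Y) :* (X :- Z) := X :* (X :- Y :- Z :+ W) :- (X :* W :- Y :* Z)) refl X Y Z W ⟩
    X * (X - Y - Z + W) - (X * W - Y * Z)  ≡⟨ cong₂ (λ h d → X * h - d) H (x≡y⇒x-y≡0 XW≡YZ) ⟩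
    X * 0# - 0#                            ≡⟨ solve 1 (λ X → X :* con 0ℤ :- con 0ℤ := con 0ℤ) refl X ⟩
    0#                                     ∎

  OnNormOneLine : V4 → Set
  OnNormOneLine v = ∃[ ω ] (NormOne ω × (OnL ω v ⊎ OnL ω (swap v)))

  onNormOneLine⇒onExtendedGenerator : ∀ {v} → OnNormOneLine v → OnExtendedGenerator v
  onNormOneLine⇒onExtendedGenerator (_ , Nω≡1 , inj₁ onL) = onL⇒onExtendedGenerator Nω≡1 onL
  onNormOneLine⇒onExtendedGenerator (_ , Nω≡1 , inj₂ onL-swap) = onExtendedGenerator-swap (onL⇒onExtendedGenerator Nω≡1 onL-swap)

  -- With the norms X, Y, Z, W of the coordinates, Q⁺ gives X W = Y Z and H gives X - Y - Z + W = 0.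
  InQ+×InH⇒onNormOneLine-α≢0 : ∀ {a b c d} → ¬ a ≡ 0# → InQ+ (v4 a b c d) → InH (v4 a b c d) → OnNormOneLine (v4 a b c d)
  InQ+×InH⇒onNormOneLine-α≢0 {a} {b} {c} {d} a≢0 Q H with N a ≟ N b
  ... | yes Na≡Nb = b * inv a , NormOne-ratio a≢0 (sym Na≡Nb) , inj₂ (sym (inv-cancelʳ a≢0 b) , d≡)
    where
    d≡ : d ≡ (b * inv a) * c
    d≡ = trans (ad-bc≡0⇒d≡ a≢0 Q) (solve 3 (λ i b c → i :* (b :* c) := (b :* i) :* c) refl (inv a) b c)
  ... | no Na≢Nb = c * inv a , NormOne-ratio a≢0 (sym (x-y≡0⇒x≡y Na-Nc≡0)) , inj₁ (sym (inv-cancelʳ a≢0 c) , d≡)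
    where
    Na-Nc≡0 : N a - N c ≡ 0#
    Na-Nc≡0 = *-cancelˡ-≡0 (λ Na-Nb≡0 → Na≢Nb (x-y≡0⇒x≡y Na-Nb≡0))
      ([X-Y][X-Z]≡0 H (trans (sym (N-* a d)) (trans (cong N (x-y≡0⇒x≡y Q)) (N-* b c))))
    d≡ : d ≡ (c * inv a) * b
    d≡ = trans (ad-bc≡0⇒d≡ a≢0 Q) (solve 3 (λ i b c → i :* (b :* c) := (c :* i) :* b) refl (inv a) b c)

  InQ+×InH⇒onNormOneLine-α≡0 : ∀ {b c d} → Nonzero (v4 0# b c d) → InQ+ (v4 0# b c d) → InH (v4 0# b c d) →
    OnNormOneLine (v4 0# b c d)
  InQ+×InH⇒onNormOneLine-α≡0 {b} {c} {d} v≢0 Q H with b ≟ 0#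
  ... | no b≢0 = d * inv b , NormOne-ratio b≢0 Nd≡Nb , inj₁ (trans c≡0 (sym (zeroʳ _)) , sym (inv-cancelʳ b≢0 d))
    where
    c≡0 : c ≡ 0#
    c≡0 = *-cancelˡ-≡0 b≢0 (begin
      b * c                     ≡⟨ solve 3 (λ b c d → b :* c := :- (con 0ℤ :* d :- b :* c)) refl b c d ⟩
      - (0# * d - b * c)        ≡⟨ cong -_ Q ⟩
      - 0#                      ≡⟨ -0≡0 ⟩
      0#                        ∎)
    Nd≡Nb : N d ≡ N b
    Nd≡Nb = x-y≡0⇒x≡y (begin
      N d - N b                 ≡⟨ solve 3 (λ z y x → x :- y := con 0ℤ :* z :- y :- con 0ℤ :* z :+ x) refl (conj 0#) (N b) (N d) ⟩
      N 0# - N b - N 0# + N d   ≡⟨ subst (λ c → N 0# - N b - N c + N d ≡ 0#) c≡0 H ⟩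
      0#                        ∎)
  ... | yes refl with c ≟ 0#
  ...   | no c≢0 = d * inv c , NormOne-ratio c≢0 Nd≡Nc , inj₂ (sym (zeroʳ _) , sym (inv-cancelʳ c≢0 d))
    where
    Nd≡Nc : N d ≡ N c
    Nd≡Nc = x-y≡0⇒x≡y (trans (solve 3 (λ z y x → x :- y := con 0ℤ :* z :- con 0ℤ :* z :- y :+ x) refl (conj 0#) (N c) (N d)) H)
  ...   | yes refl = ⊥-elim (v≢0 (refl , refl , refl , N≡0⇒x≡0 Nd≡0))
    where
    Nd≡0 : N d ≡ 0#
    Nd≡0 = trans (solve 2 (λ z x → x := con 0ℤ :* z :- con 0ℤ :* z :- con 0ℤ :* z :+ x) refl (conj 0#) (N d)) H

  InQ+×InH⇒onNormOneLine : ∀ {v} → Nonzero v → InQ+ v → InH v → OnNormOneLine v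
  InQ+×InH⇒onNormOneLine {v4 a b c d} v≢0 Q H with a ≟ 0#
  ... | no a≢0 = InQ+×InH⇒onNormOneLine-α≢0 a≢0 Q H
  ... | yes refl = InQ+×InH⇒onNormOneLine-α≡0 v≢0 Q H

  InQ+×InH⇔InQ0⊎onExtendedGenerator : ∀ {v} → Nonzero v → (InQ+ v × InH v) ⇔ (InQ0 v ⊎ OnExtendedGenerator v)
  InQ+×InH⇔InQ0⊎onExtendedGenerator v≢0 = mk⇔
    (λ (Q , H) → inj₂ (onNormOneLine⇒onExtendedGenerator (InQ+×InH⇒onNormOneLine v≢0 Q H)))
    [ (λ Q0 → proj₂ Q0 , InQ0⇒InH Q0) , onExtendedGenerator⇒InQ+×InH ]

frobeniusInvolution : ∀ {q} → OddPrimePower q → (F : Field) → HasOrder F (q ℕ.* q) → FrobeniusInvolution F q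
frobeniusInvolution {q} (p , k , p-prime , _ , 1≤k , refl) F enumeration = record
  { ^q-homo-+ = ^q-homo-+
  ; ^q-involutive = λ x → trans (^-assocʳ x q q) (x^n≡x x)
  ; nonFixed = proj₁ nonFixed
  ; nonFixed^q≢nonFixed = proj₂ nonFixed
  }
  where
  open FieldProperties F
  open FiniteField F enumeration
  p·1≡0 : p · 1# ≡ 0#
  p·1≡0 = n≡p^m⇒p·1≡0 {p} {k ℕ.+ k} (sym (ℕ.^-distribˡ-+-* p k k))
  ^q-homo-+ : ∀ x y → (x + y) ^ q ≡ x ^ q + y ^ q
  ^q-homo-+ x y rewrite ^≡Exp^ (x + y) q | ^≡Exp^ x q | ^≡Exp^ y q =
    FreshmansDream.^pᵏ-homo-+ commutativeSemiring p-prime p·1≡0 k x y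
  2≤q : 2 ≤ q
  2≤q = ℕ.≤-trans (2≤p p-prime) (ℕ.≤-trans (ℕ.≤-reflexive (sym (ℕ.*-identityʳ p))) (ℕ.^-monoʳ-≤ p {{prime⇒nonZero p-prime}} 1≤k))
  q<q*q : q < q ℕ.* q
  q<q*q = ℕ.m<m*n q q {{ℕ.>-nonZero (ℕ.<-trans (s≤s z≤n) 2≤q)}} 2≤q
  nonFixed : ∃[ e ] ¬ e ^ q ≡ e
  nonFixed = ∃x^m≢x 2≤q q<q*q

open import Data.Nat using (_*_)

mainTheorem7 : (q : ℕ) → OddPrimePower q → (F : Field) → HasOrder F (q * q) →
    let open Geometry F q in
    (v : V4) → Nonzero v →
    ((InQ+ v × InH v) ⇔ (InQ0 v ⊎ OnExtendedGenerator v))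
mainTheorem7 q q-prime-power F enumeration v =
  HermitianGeometry.InQ+×InH⇔InQ0⊎onExtendedGenerator F q
    (frobeniusInvolution q-prime-power F enumeration) (FiniteField._≟_ F enumeration)
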